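{- Let $G$ be a directed acyclic graph on vertex set $V$ and let $\pi:V\to\{1,\dots,n\}$ be a bijection with $\pi(x)<\pi(y)$ for every edge $xy$ of $G$. Let $uv$ be an edge such that $\pi(u)>\pi(v)$ and $G\cup\{uv\}$ is acyclic. Let $W=\{w\in V:\pi(v)\le\pi(w)\le\pi(u)\}$, let $T\subseteq W$ be the set of vertices of $W$ reachable from $v$ in $G$ (including $v$), let $S\subseteq W$ be the set of vertices of $W$ that can reach $u$ in $G$ (including $u$), and let $Z=W\setminus(S\cup T)$. Then, in $G\cup\{uv\}$: no vertex $t\in T$ can reach a vertex $s\in S$; no vertex $t\in T$ can reach a vertex $z\in Z$; and no vertex $z\in Z$ can reach a vertex $s\in S$. -}

module Defs where

open import Level using (Level; _⊔_)
open import Data.Nat using (ℕ)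
open import Data.Fin using (Fin; _<_; _≤_)
open import Data.Product using (_×_; ∃)
open import Data.Sum using (_⊎_)
open import Relation.Binary.PropositionalEquality using (_≡_)
open import Relation.Binary.Construct.Closure.ReflexiveTransitive using (Star)
open import Relation.Binary.Construct.Closure.Transitive using (TransClosure)
open import Relation.Nullary using (¬_)
open import Function.Bundles using (_⤖_; Bijection)

Graph : ∀ {a} → Set a → (ℓ : Level) → Set (a ⊔ Level.suc ℓ)
Graph V ℓ = V → V → Set ℓ

Reaches : ∀ {a ℓ} {V : Set a} → Graph V ℓ → V → V → Set (a ⊔ ℓ)
Reaches G = Star G

Acyclic : ∀ {a ℓ} {V : Set a} → Graph V ℓ → Set (a ⊔ ℓ)
Acyclic {V = V} G = ∀ (x : V) → ¬ TransClosure G x x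

addEdge : ∀ {a ℓ} {V : Set a} → Graph V ℓ → V → V → Graph V (a ⊔ ℓ)
addEdge G u v x y = G x y ⊎ (x ≡ u × y ≡ v)

{-# OPTIONS --safe #-}
module Submission where

open import Defs
open import Data.Nat using (ℕ)
open import Data.Fin using (Fin; _<_; _≤_)
open import Data.Product using (_×_; _,_)
open import Data.Sum using (_⊎_; inj₁; inj₂)
open import Relation.Nullary using (¬_; contradiction)
open import Function.Bundles using (_⤖_; Bijection)
open import Relation.Binary.PropositionalEquality using (refl)
open import Relation.Binary.Construct.Closure.ReflexiveTransitive using (Star; ε; _◅_; _◅◅_)
  renaming (map to Star-map)
open import Relation.Binary.Construct.Closure.Transitive using (TransClosure; [_]; _∷_)

-- A path in G ∪ {uv} either avoids uv or begins with a path in G to u.  So the descendants of v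
-- in G are closed under reachability in G ∪ {uv} unless one of them reaches u, which would
-- close the cycle v ⇝ u → v; and the ancestors of u in G are closed under reachability
-- backwards in G ∪ {uv} outright.

star-∷ʳ : ∀ {a ℓ} {A : Set a} {R : A → A → Set ℓ} {x y z} →
          Star R x y → R y z → TransClosure R x z
star-∷ʳ ε        yz = [ yz ]
star-∷ʳ (e ◅ xy) yz = e ∷ star-∷ʳ xy yz

acyclic⇒¬reaches-back : ∀ {a ℓ} {V : Set a} {G : Graph V ℓ} {x y} →
                        Acyclic G → G y x → ¬ Reaches G x y
acyclic⇒¬reaches-back acyclic yx xy = acyclic _ (star-∷ʳ xy yx)

module _ {a ℓ} {V : Set a} {G : Graph V ℓ} {u v : V} where

  reaches-addEdge⁺ : ∀ {x y} → Reaches G x y → Reaches (addEdge G u v) x y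
  reaches-addEdge⁺ = Star-map inj₁

  reaches-addEdge⁻ : ∀ {x y} → Reaches (addEdge G u v) x y → Reaches G x y ⊎ Reaches G x u
  reaches-addEdge⁻ ε                        = inj₁ ε
  reaches-addEdge⁻ (inj₂ (refl , refl) ◅ _) = inj₂ ε
  reaches-addEdge⁻ (inj₁ e ◅ p) with reaches-addEdge⁻ p
  ... | inj₁ xy = inj₁ (e ◅ xy)
  ... | inj₂ xu = inj₂ (e ◅ xu)

  module _ (acyclic′ : Acyclic (addEdge G u v)) where

    ¬descendant-reaches-ancestor : ∀ {t s} → Reaches G v t → Reaches G s u →
                                   ¬ Reaches (addEdge G u v) t s
    ¬descendant-reaches-ancestor vt su ts =
      acyclic⇒¬reaches-back acyclic′ (inj₂ (refl , refl))
        (reaches-addEdge⁺ vt ◅◅ ts ◅◅ reaches-addEdge⁺ su)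

    descendant-reaches⇒descendant : ∀ {t z} → Reaches G v t → Reaches (addEdge G u v) t z →
                                    Reaches G v z
    descendant-reaches⇒descendant vt tz with reaches-addEdge⁻ tz
    ... | inj₁ tz′ = vt ◅◅ tz′
    ... | inj₂ tu  = contradiction (reaches-addEdge⁺ tu) (¬descendant-reaches-ancestor vt ε)

  reaches-ancestor⇒ancestor : ∀ {z s} → Reaches G s u → Reaches (addEdge G u v) z s →
                              Reaches G z u
  reaches-ancestor⇒ancestor su zs with reaches-addEdge⁻ zs
  ... | inj₁ zs′ = zs′ ◅◅ su
  ... | inj₂ zu  = zu

lemma3p2 : ∀ {a ℓ} {V : Set a} {n : ℕ} (G : Graph V ℓ) (π : V ⤖ Fin n) (u v : V) →
    let π′ = Bijection.to π in
    Acyclic G →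
    (∀ x y → G x y → π′ x < π′ y) →
    π′ v < π′ u →
    Acyclic (addEdge G u v) →
    let W : V → Set
        W w = (π′ v ≤ π′ w) × (π′ w ≤ π′ u)
        T : V → Set _
        T w = W w × Reaches G v w
        S : V → Set _
        S w = W w × Reaches G w u
        Z : V → Set _
        Z w = W w × ¬ S w × ¬ T w
    in (∀ t s → T t → S s → ¬ Reaches (addEdge G u v) t s)
     × (∀ t z → T t → Z z → ¬ Reaches (addEdge G u v) t z)
     × (∀ z s → Z z → S s → ¬ Reaches (addEdge G u v) z s)
lemma3p2 G π u v _ _ _ acyclic′ =
    (λ t s (_ , vt) (_ , su) → ¬descendant-reaches-ancestor acyclic′ vt su)
  , (λ t z (_ , vt) (wz , _ , z∉T) tz → z∉T (wz , descendant-reaches⇒descendant acyclic′ vt tz))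
  , (λ z s (wz , z∉S , _) (_ , su) zs → z∉S (wz , reaches-ancestor⇒ancestor su zs))
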